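{- Let $G$ be a graph and $u,v\in V(G)$. (i) If $u$ and $v$ are false twins and $S$ is a general position set (respectively, a mutual-visibility set) of $G$ such that $S\cap\{u,v\}=\{u\}$, then $(S\setminus\{u\})\cup\{v\}$ is also a general position set (respectively, a mutual-visibility set) of $G$. (ii) If $u$ and $v$ are true twins and $S$ is a general position set of $G$ with $u\in S$, then $S\cup\{v\}$ is also a general position set of $G$.
   Context: All graphs are finite and simple. Vertices $x,y$ are false twins if $N_G(x)=N_G(y)$ (open neighborhoods), and true twins if $N_G[x]=N_G[y]$ (closed neighborhoods). A set $S\subseteq V(G)$ is a general position set if no three vertices of $S$ lie on a common shortest path of $G$. Given $S\subseteq V(G)$, two vertices $x,y$ are $S$-visible if there exists a shortest $x,y$-path in $G$ none of whose internal vertices belongs to $S$; $S$ is a mutual-visibility set if every two vertices of $S$ are $S$-visible. -}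

module Defs where

open import Data.Nat using (ℕ; zero; suc; _≤_)
open import Data.Fin using (Fin)
open import Data.Fin.Subset using (Subset; _∈_; _∉_)
open import Data.Bool using (Bool; true; false)
open import Data.Product using (Σ; ∃; _×_; _,_)
open import Data.Sum using (_⊎_)
open import Relation.Binary.PropositionalEquality using (_≡_)
open import Relation.Nullary using (¬_)

record Graph : Set where
  field
    n     : ℕ
    adj   : Fin n → Fin n → Bool
    sym   : ∀ x y → adj x y ≡ adj y x
    irref : ∀ x → adj x x ≡ false

open Graph public

V : Graph → Set
V G = Fin (n G)

Adj : (G : Graph) → V G → V G → Set
Adj G x y = adj G x y ≡ true

data Walk (G : Graph) : V G → V G → ℕ → Set where
  nil  : ∀ {x} → Walk G x x 0
  cons : ∀ {x y z k} → Adj G x y → Walk G y z k → Walk G x z (suc k)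

IsShortest : (G : Graph) {x y : V G} {k : ℕ} → Walk G x y k → Set
IsShortest G {x} {y} {k} _ = ∀ {k'} → Walk G x y k' → k ≤ k'

data _∈W_ {G : Graph} (v : V G) : ∀ {x y k} → Walk G x y k → Set where
  here-nil  : ∀ {x} → v ≡ x → v ∈W (nil {x = x})
  here-cons : ∀ {x y z k} {e : Adj G x y} {w : Walk G y z k} → v ≡ x → v ∈W cons e w
  there     : ∀ {x y z k} {e : Adj G x y} {w : Walk G y z k} → v ∈W w → v ∈W cons e w

data _∈Init_ {G : Graph} (v : V G) : ∀ {x y k} → Walk G x y k → Set where
  here  : ∀ {x y z k} {e : Adj G x y} {w : Walk G y z k} → v ≡ x → v ∈Init cons e w
  there : ∀ {x y z k} {e : Adj G x y} {w : Walk G y z k} → v ∈Init w → v ∈Init cons e w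

data _∈Internal_ {G : Graph} (v : V G) : ∀ {x y k} → Walk G x y k → Set where
  int : ∀ {x y z k} {e : Adj G x y} {w : Walk G y z k} → v ∈Init w → v ∈Internal cons e w

OnCommonShortestPath : (G : Graph) → V G → V G → V G → Set
OnCommonShortestPath G a b c =
  Σ (V G) λ x → Σ (V G) λ y → Σ ℕ λ k → Σ (Walk G x y k) λ w →
    IsShortest G w × a ∈W w × b ∈W w × c ∈W w

GeneralPosition : (G : Graph) → Subset (n G) → Set
GeneralPosition G S = ∀ a b c → a ∈ S → b ∈ S → c ∈ S →
  ¬ a ≡ b → ¬ a ≡ c → ¬ b ≡ c → ¬ OnCommonShortestPath G a b c

Visible : (G : Graph) → Subset (n G) → V G → V G → Set
Visible G S x y = Σ ℕ λ k → Σ (Walk G x y k) λ w →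
  IsShortest G w × (∀ v → v ∈Internal w → v ∉ S)

MutualVisibility : (G : Graph) → Subset (n G) → Set
MutualVisibility G S = ∀ x y → x ∈ S → y ∈ S → Visible G S x y

N⟨_⟩ : (G : Graph) → V G → V G → Set
N⟨ G ⟩ x w = Adj G x w

N[_] : (G : Graph) → V G → V G → Set
N[ G ] x w = Adj G x w ⊎ w ≡ x

FalseTwins : (G : Graph) → V G → V G → Set
FalseTwins G x y = ∀ w → (N⟨ G ⟩ x w → N⟨ G ⟩ y w) × (N⟨ G ⟩ y w → N⟨ G ⟩ x w)

TrueTwins : (G : Graph) → V G → V G → Set
TrueTwins G x y = ∀ w → (N[ G ] x w → N[ G ] y w) × (N[ G ] y w → N[ G ] x w)

-- The transposition of two twins u and v is an automorphism of G, and general position and mutual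
-- visibility only depend on shortest paths, so they are invariant under automorphisms. In (i) the
-- transposition maps (S ∖ {u}) ∪ {v} into S. In (ii) it maps a triple of S ∪ {v} through v but not u
-- onto a triple of S. A triple containing both u and v is impossible: u and v are adjacent, and the
-- transposition fixes the third vertex b, so d(b,u) = d(b,v). On a shortest path, b cannot lie strictly
-- between the adjacent u and v, and d(b,u) = d(b,v) forbids either twin to lie between b and the other.
module Submission where

open import Defs hiding (sym)
open import Data.Empty using (⊥; ⊥-elim)
open import Data.Fin using (Fin; _≟_)
open import Data.Fin.Permutation using (Permutation′; _⟨$⟩ʳ_; _⟨$⟩ˡ_; inverseˡ; flip; transpose)
import Data.Fin.Permutation.Components as PC
open import Data.Fin.Subset using (Subset; _∈_; _∉_; _∪_; _-_; _─_; ⁅_⁆; outside)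
open import Data.Fin.Subset.Properties using (x∈p∪q⁻; x∈⁅x⁆; x∈⁅y⁆⇒x≡y; p─q⊆p)
open import Data.Nat using (ℕ; suc; _+_; _≤_; _<_; z≤n; s≤s)
open import Data.Nat.Properties
  using (+-assoc; +-cancelˡ-≤; +-cancelʳ-≤; +-mono-≤; ≤-trans; <-≤-trans; m<m+n; m<n+m; n≮n)
open import Data.Product using (Σ; _×_; _,_; proj₁; proj₂)
import Data.Product as Product
open import Data.Sum using (_⊎_; inj₁; inj₂; [_,_]′)
import Data.Sum as Sum
open import Data.Vec.Base using (_∷_; here; there)
open import Function using (_∘_; id)
open import Relation.Nullary using (¬_; Dec; yes; no)
open import Relation.Nullary.Decidable using (dec-true; dec-false)
open import Relation.Binary.PropositionalEquality
  using (_≡_; _≢_; refl; sym; trans; cong; subst; subst₂; ≢-sym; module ≡-Reasoning)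

private
  variable
    G : Graph
    k k₁ k₂ : ℕ

adj-sym : (G : Graph) {x y : V G} → Adj G x y → Adj G y x
adj-sym G {x} {y} = trans (Graph.sym G y x)

adj⇒≢ : (G : Graph) {x y : V G} → Adj G x y → x ≢ y
adj⇒≢ G {x} xy refl with trans (sym (irref G x)) xy
... | ()

_++ᵂ_ : ∀ {x y z} → Walk G x y k₁ → Walk G y z k₂ → Walk G x z (k₁ + k₂)
nil      ++ᵂ w = w
cons e v ++ᵂ w = cons e (v ++ᵂ w)

≢⇒length>0 : ∀ {x y} → x ≢ y → Walk G x y k → 0 < k
≢⇒length>0 x≢y nil        = ⊥-elim (x≢y refl)
≢⇒length>0 _   (cons _ _) = s≤s z≤n

-- IsShortest G w unfolds to NoShorterThan G x y k: it only depends on the endpoints and the length of w.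
NoShorterThan : (G : Graph) → V G → V G → ℕ → Set
NoShorterThan G x y k = ∀ {k′} → Walk G x y k′ → k ≤ k′

infix-no-shorter : ∀ {x a c y i j l} → Walk G x a i → Walk G c y l →
  NoShorterThan G x y k → i + (j + l) ≡ k → NoShorterThan G a c j
infix-no-shorter {i = i} {l = l} A C bound refl W =
  +-cancelʳ-≤ l _ _ (+-cancelˡ-≤ i _ _ (bound (A ++ᵂ (W ++ᵂ C))))

record Between (G : Graph) (a m c : V G) : Set where
  field
    {i j}    : ℕ
    left     : Walk G a m i
    right    : Walk G m c j
    shortest : NoShorterThan G a c (i + j)

module _ {a m c : V G} (β : Between G a m c) where
  open Between β

  ¬between-adjacent : Adj G a c → a ≢ m → m ≢ c → ⊥
  ¬between-adjacent ac a≢m m≢c =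
    n≮n 1 (≤-trans (+-mono-≤ (≢⇒length>0 a≢m left) (≢⇒length>0 m≢c right)) (shortest (cons ac nil)))

  ¬between-shortcutˡ : m ≢ c → ¬ Walk G a c i
  ¬between-shortcutˡ m≢c W = n≮n i (<-≤-trans (m<m+n i (≢⇒length>0 m≢c right)) (shortest W))

  ¬between-shortcutʳ : a ≢ m → ¬ Walk G a c j
  ¬between-shortcutʳ a≢m W = n≮n j (<-≤-trans (m<n+m j (≢⇒length>0 a≢m left)) (shortest W))

record Cut {x y} (w : Walk G x y k) (c : V G) : Set where
  field
    {i j}  : ℕ
    prefix : Walk G x c i
    suffix : Walk G c y j
    length : i + j ≡ k
    covers : ∀ {d} → d ∈W w → d ∈W prefix ⊎ d ∈W suffix

cut : ∀ {x y c} {w : Walk G x y k} → c ∈W w → Cut w c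
cut (here-nil refl) = record { prefix = nil ; suffix = nil ; length = refl ; covers = inj₁ }
cut {w = cons e w} (here-cons refl) =
  record { prefix = nil ; suffix = cons e w ; length = refl ; covers = inj₂ }
cut {w = cons e w} (there c∈w) =
  record { prefix = cons e prefix ; suffix = suffix ; length = cong suc length ; covers = covers′ }
  where
  open Cut (cut c∈w)
  covers′ : ∀ {d} → d ∈W cons e w → d ∈W cons e prefix ⊎ d ∈W suffix
  covers′ (here-cons d≡x) = inj₁ (here-cons d≡x)
  covers′ (there d∈w)     = Sum.map₁ there (covers d∈w)

record Chain {x y} (w : Walk G x y k) (a b : V G) : Set where
  field
    {i j l} : ℕ
    first   : Walk G x a i
    middle  : Walk G a b j
    last    : Walk G b y l
    length  : i + (j + l) ≡ k
    covers  : ∀ {d} → d ∈W w → d ∈W first ⊎ d ∈W middle ⊎ d ∈W last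

module _ {x y a b : V G} {w : Walk G x y k} (C : Cut w a) where
  private module C = Cut C

  chain-before : Cut C.prefix b → Chain w b a
  chain-before D = record
    { first = D.prefix ; middle = D.suffix ; last = C.suffix
    ; length = trans (sym (+-assoc D.i D.j C.j)) (trans (cong (_+ C.j) D.length) C.length)
    ; covers = λ d∈w → [ Sum.map₂ inj₁ ∘ D.covers , inj₂ ∘ inj₂ ]′ (C.covers d∈w)
    }
    where module D = Cut D

  chain-after : Cut C.suffix b → Chain w a b
  chain-after D = record
    { first = C.prefix ; middle = D.prefix ; last = D.suffix
    ; length = trans (cong (C.i +_) D.length) C.length
    ; covers = λ d∈w → [ inj₁ , inj₂ ∘ D.covers ]′ (C.covers d∈w)
    }
    where module D = Cut D

ordered : ∀ {x y a b} {w : Walk G x y k} → a ∈W w → b ∈W w → Chain w a b ⊎ Chain w b a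
ordered a∈w b∈w =
  [ inj₂ ∘ chain-before C ∘ cut , inj₁ ∘ chain-after C ∘ cut ]′ (Cut.covers C b∈w)
  where C = cut a∈w

module _ {x y p q : V G} {w : Walk G x y k} (bound : NoShorterThan G x y k) (C : Chain w p q) where
  open Chain C
  open ≡-Reasoning

  between-before : ∀ {b} → Cut first b → Between G b p q
  between-before D = record
    { left = D.suffix ; right = middle ; shortest = infix-no-shorter D.prefix last bound lengths }
    where
    module D = Cut D
    lengths : D.i + ((D.j + j) + l) ≡ k
    lengths = begin
      D.i + ((D.j + j) + l)  ≡⟨ cong (D.i +_) (+-assoc D.j j l) ⟩
      D.i + (D.j + (j + l))  ≡⟨ sym (+-assoc D.i D.j (j + l)) ⟩
      (D.i + D.j) + (j + l)  ≡⟨ cong (_+ (j + l)) D.length ⟩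
      i + (j + l)            ≡⟨ length ⟩
      k                      ∎

  between-inside : ∀ {b} → Cut middle b → Between G p b q
  between-inside D = record
    { left = D.prefix ; right = D.suffix
    ; shortest = infix-no-shorter first last bound (trans (cong (λ t → i + (t + l)) D.length) length)
    }
    where module D = Cut D

  between-after : ∀ {b} → Cut last b → Between G p q b
  between-after D = record
    { left = middle ; right = D.prefix ; shortest = infix-no-shorter first D.suffix bound lengths }
    where
    module D = Cut D
    lengths : i + ((j + D.i) + D.j) ≡ k
    lengths = trans (cong (i +_) (trans (+-assoc j D.i D.j) (cong (j +_) D.length))) length

  locate : ∀ {b} → b ∈W w → Between G b p q ⊎ Between G p b q ⊎ Between G p q b
  locate b∈w =
    Sum.map (between-before ∘ cut) (Sum.map (between-inside ∘ cut) (between-after ∘ cut)) (covers b∈w)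

record Automorphism (G : Graph) : Set where
  field
    perm     : Permutation′ (n G)
    to-adj   : ∀ {x y} → Adj G x y → Adj G (perm ⟨$⟩ʳ x) (perm ⟨$⟩ʳ y)
    from-adj : ∀ {x y} → Adj G x y → Adj G (perm ⟨$⟩ˡ x) (perm ⟨$⟩ˡ y)

open Automorphism

infixl 25 _⟨$⟩_
infix 30 _⁻¹

_⟨$⟩_ : Automorphism G → V G → V G
σ ⟨$⟩ x = perm σ ⟨$⟩ʳ x

_⁻¹ : Automorphism G → Automorphism G
σ ⁻¹ = record { perm = flip (perm σ) ; to-adj = from-adj σ ; from-adj = to-adj σ }

module _ (σ : Automorphism G) where

  mapᵂ : ∀ {x y} → Walk G x y k → Walk G (σ ⟨$⟩ x) (σ ⟨$⟩ y) k
  mapᵂ nil        = nil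
  mapᵂ (cons e w) = cons (to-adj σ e) (mapᵂ w)

  walk-image : ∀ {x x′ y y′} → σ ⟨$⟩ x ≡ x′ → σ ⟨$⟩ y ≡ y′ → Walk G x y k → Walk G x′ y′ k
  walk-image refl refl = mapᵂ

  ∈W-map : ∀ {c x y} {w : Walk G x y k} → c ∈W w → σ ⟨$⟩ c ∈W mapᵂ w
  ∈W-map (here-nil c≡x)  = here-nil (cong (σ ⟨$⟩_) c≡x)
  ∈W-map (here-cons c≡x) = here-cons (cong (σ ⟨$⟩_) c≡x)
  ∈W-map (there c∈w)     = there (∈W-map c∈w)

  ∈Init-map⁻ : ∀ {z x y} (w : Walk G x y k) →
    z ∈Init mapᵂ w → Σ (V G) λ z′ → z′ ∈Init w × σ ⟨$⟩ z′ ≡ z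
  ∈Init-map⁻ (cons {x = x} e w) (here z≡σx) = x , here refl , sym z≡σx
  ∈Init-map⁻ (cons e w)         (there z∈w) = Product.map₂ (Product.map₁ there) (∈Init-map⁻ w z∈w)

  ∈Internal-map⁻ : ∀ {z x y} (w : Walk G x y k) →
    z ∈Internal mapᵂ w → Σ (V G) λ z′ → z′ ∈Internal w × σ ⟨$⟩ z′ ≡ z
  ∈Internal-map⁻ (cons e w) (int z∈w) = Product.map₂ (Product.map₁ int) (∈Init-map⁻ w z∈w)

module _ (σ : Automorphism G) where

  no-shorter-map : ∀ {x y} → NoShorterThan G x y k → NoShorterThan G (σ ⟨$⟩ x) (σ ⟨$⟩ y) k
  no-shorter-map bound W = bound (walk-image (σ ⁻¹) (inverseˡ (perm σ)) (inverseˡ (perm σ)) W)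

  on-common-shortest-path-image : ∀ {a a′ b b′ c c′} →
    σ ⟨$⟩ a ≡ a′ → σ ⟨$⟩ b ≡ b′ → σ ⟨$⟩ c ≡ c′ →
    OnCommonShortestPath G a b c → OnCommonShortestPath G a′ b′ c′
  on-common-shortest-path-image refl refl refl (x , y , k , w , sh , a∈w , b∈w , c∈w) =
    σ ⟨$⟩ x , σ ⟨$⟩ y , k , mapᵂ σ w , no-shorter-map sh , ∈W-map σ a∈w , ∈W-map σ b∈w , ∈W-map σ c∈w

  ⟨$⟩-injective : ∀ {a b} → σ ⟨$⟩ a ≡ σ ⟨$⟩ b → a ≡ b
  ⟨$⟩-injective σa≡σb =
    trans (sym (inverseˡ (perm σ))) (trans (cong (σ ⁻¹ ⟨$⟩_) σa≡σb) (inverseˡ (perm σ)))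

  generalPosition-pullback : ∀ {S T : Subset (n G)} → (∀ {z} → z ∈ T → σ ⟨$⟩ z ∈ S) →
    GeneralPosition G S → GeneralPosition G T
  generalPosition-pullback T⇒S gp a b c a∈T b∈T c∈T a≢b a≢c b≢c abc =
    gp _ _ _ (T⇒S a∈T) (T⇒S b∈T) (T⇒S c∈T)
      (a≢b ∘ ⟨$⟩-injective) (a≢c ∘ ⟨$⟩-injective) (b≢c ∘ ⟨$⟩-injective)
      (on-common-shortest-path-image refl refl refl abc)

  visible-map : ∀ {S T : Subset (n G)} {x y} → (∀ {z} → z ∈ T → σ ⁻¹ ⟨$⟩ z ∈ S) →
    Visible G S x y → Visible G T (σ ⟨$⟩ x) (σ ⟨$⟩ y)
  visible-map T⇒S (k , w , sh , unseen) = k , mapᵂ σ w , no-shorter-map sh , unseen′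
    where
    unseen′ : ∀ z → z ∈Internal mapᵂ σ w → z ∉ _
    unseen′ z z∈w z∈T with ∈Internal-map⁻ σ w z∈w
    ... | z′ , z′∈w , refl = unseen z′ z′∈w (subst (_∈ _) (inverseˡ (perm σ)) (T⇒S z∈T))

mutualVisibility-pullback : (σ : Automorphism G) {S T : Subset (n G)} →
  (∀ {z} → z ∈ T → σ ⟨$⟩ z ∈ S) → MutualVisibility G S → MutualVisibility G T
mutualVisibility-pullback σ T⇒S mv x y x∈T y∈T =
  subst₂ (Visible _ _) (inverseˡ (perm σ)) (inverseˡ (perm σ))
    (visible-map (σ ⁻¹) T⇒S (mv _ _ (T⇒S x∈T) (T⇒S y∈T)))

module _ {m} (u v : Fin m) where

  transpose-matchˡ : PC.transpose u v u ≡ v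
  transpose-matchˡ rewrite dec-true (u ≟ u) refl = refl

  transpose-matchʳ : PC.transpose u v v ≡ u
  transpose-matchʳ with v ≟ u
  ... | yes v≡u = v≡u
  ... | no _ rewrite dec-true (v ≟ v) refl = refl

  transpose-fixed : ∀ {z} → z ≢ u → z ≢ v → PC.transpose u v z ≡ z
  transpose-fixed {z} z≢u z≢v rewrite dec-false (z ≟ u) z≢u | dec-false (z ≟ v) z≢v = refl

  TransposeCases : Fin m → Set
  TransposeCases z = z ≡ u × PC.transpose u v z ≡ v
                   ⊎ z ≡ v × PC.transpose u v z ≡ u
                   ⊎ z ≢ u × z ≢ v × PC.transpose u v z ≡ z

  transpose-cases : ∀ z → TransposeCases z
  transpose-cases z = decide (z ≟ u) (z ≟ v)
    where
    decide : ∀ {z} → Dec (z ≡ u) → Dec (z ≡ v) → TransposeCases z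
    decide (yes refl) _          = inj₁ (refl , transpose-matchˡ)
    decide (no _)     (yes refl) = inj₂ (inj₁ (refl , transpose-matchʳ))
    decide (no z≢u)   (no z≢v)   = inj₂ (inj₂ (z≢u , z≢v , transpose-fixed z≢u z≢v))

-- Both false and true twins are interchangeable: they agree on all neighbours outside {u, v}.
Interchangeable : (G : Graph) → V G → V G → Set
Interchangeable G u v = ∀ {w} → w ≢ u → w ≢ v → Adj G u w → Adj G v w

module _ {G : Graph} {u v : V G} (uv : Interchangeable G u v) (vu : Interchangeable G v u) where

  transpose-adj : ∀ {x y} → Adj G x y → Adj G (PC.transpose u v x) (PC.transpose u v y)
  transpose-adj {x} {y} xy with transpose-cases u v x | transpose-cases u v y
  ... | inj₁ (refl , _) | inj₁ (refl , _) = ⊥-elim (adj⇒≢ G xy refl)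
  ... | inj₁ (refl , σx) | inj₂ (inj₁ (refl , σy)) rewrite σx | σy = adj-sym G xy
  ... | inj₁ (refl , σx) | inj₂ (inj₂ (y≢u , y≢v , σy)) rewrite σx | σy = uv y≢u y≢v xy
  ... | inj₂ (inj₁ (refl , σx)) | inj₁ (refl , σy) rewrite σx | σy = adj-sym G xy
  ... | inj₂ (inj₁ (refl , _)) | inj₂ (inj₁ (refl , _)) = ⊥-elim (adj⇒≢ G xy refl)
  ... | inj₂ (inj₁ (refl , σx)) | inj₂ (inj₂ (y≢u , y≢v , σy)) rewrite σx | σy = vu y≢v y≢u xy
  ... | inj₂ (inj₂ (x≢u , x≢v , σx)) | inj₁ (refl , σy) rewrite σx | σy =
    adj-sym G (uv x≢u x≢v (adj-sym G xy))
  ... | inj₂ (inj₂ (x≢u , x≢v , σx)) | inj₂ (inj₁ (refl , σy)) rewrite σx | σy =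
    adj-sym G (vu x≢v x≢u (adj-sym G xy))
  ... | inj₂ (inj₂ (x≢u , x≢v , σx)) | inj₂ (inj₂ (y≢u , y≢v , σy)) rewrite σx | σy = xy

swap : ∀ {u v : V G} → Interchangeable G u v → Interchangeable G v u → Automorphism G
swap {G} {u} {v} uv vu = record
  { perm = transpose u v ; to-adj = transpose-adj {G} uv vu ; from-adj = transpose-adj {G} vu uv }

module _ {G : Graph} (σ : Automorphism G) {p q b : V G}
         (σb≡b : σ ⟨$⟩ b ≡ b) (σp≡q : σ ⟨$⟩ p ≡ q) (σq≡p : σ ⟨$⟩ q ≡ p)
         (pq : Adj G p q) (p≢b : p ≢ b) (q≢b : q ≢ b) where

  ¬chain-through-swapped-edge : ∀ {x y} {w : Walk G x y k} →
    NoShorterThan G x y k → Chain w p q → ¬ b ∈W w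
  ¬chain-through-swapped-edge bound C b∈w with locate bound C b∈w
  ... | inj₁ β        = ¬between-shortcutˡ β (adj⇒≢ G pq) (walk-image σ σb≡b σp≡q (Between.left β))
  ... | inj₂ (inj₁ β) = ¬between-adjacent β pq p≢b (≢-sym q≢b)
  ... | inj₂ (inj₂ β) = ¬between-shortcutʳ β (adj⇒≢ G pq) (walk-image σ σq≡p σb≡b (Between.right β))

¬shortest-through-swapped-edge : ∀ {G : Graph} (σ : Automorphism G) {p q b x y : V G} →
  σ ⟨$⟩ b ≡ b → σ ⟨$⟩ p ≡ q → σ ⟨$⟩ q ≡ p → Adj G p q → p ≢ b → q ≢ b →
  (w : Walk G x y k) → IsShortest G w → p ∈W w → q ∈W w → ¬ b ∈W w
¬shortest-through-swapped-edge {G = G} σ σb≡b σp≡q σq≡p pq p≢b q≢b w sh p∈w q∈w =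
  [ ¬chain-through-swapped-edge σ σb≡b σp≡q σq≡p pq p≢b q≢b sh
  , ¬chain-through-swapped-edge σ σb≡b σq≡p σp≡q (adj-sym G pq) q≢b p≢b sh
  ]′ (ordered p∈w q∈w)

falseTwins⇒swap : ∀ {u v : V G} → FalseTwins G u v → Automorphism G
falseTwins⇒swap ft = swap (λ _ _ → proj₁ (ft _)) (λ _ _ → proj₂ (ft _))

trueTwins⇒interchangeable : ∀ {u v : V G} → TrueTwins G u v → Interchangeable G u v
trueTwins⇒interchangeable tt {w} _ w≢v uw = [ id , ⊥-elim ∘ w≢v ]′ (proj₁ (tt w) (inj₁ uw))

trueTwins-sym : ∀ {u v : V G} → TrueTwins G u v → TrueTwins G v u
trueTwins-sym tt w = Product.swap (tt w)

trueTwins⇒swap : ∀ {G : Graph} {u v : V G} → TrueTwins G u v → Automorphism G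
trueTwins⇒swap {G} tt =
  swap (trueTwins⇒interchangeable {G} tt) (trueTwins⇒interchangeable {G} (trueTwins-sym {G} tt))

trueTwins⇒adj : ∀ {G : Graph} {u v : V G} → TrueTwins G u v → u ≢ v → Adj G u v
trueTwins⇒adj {G} {u} tt u≢v = [ adj-sym G , ⊥-elim ∘ u≢v ]′ (proj₁ (tt u) (inj₂ refl))

x∈p─q⇒x∉q : ∀ {m} (p q : Subset m) {x} → x ∈ p ─ q → x ∉ q
x∈p─q⇒x∉q (_ ∷ p) (outside ∷ q) here        ()
x∈p─q⇒x∉q (_ ∷ p) (_ ∷ q)       (there x∈p─q) (there x∈q) = x∈p─q⇒x∉q p q x∈p─q x∈q

x∈p∪⁅y⁆∧x≢y⇒x∈p : ∀ {m} {p : Subset m} {x y} → x ∈ p ∪ ⁅ y ⁆ → x ≢ y → x ∈ p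
x∈p∪⁅y⁆∧x≢y⇒x∈p {p = p} {y = y} x∈p∪⁅y⁆ x≢y =
  [ id , ⊥-elim ∘ x≢y ∘ x∈⁅y⁆⇒x≡y y ]′ (x∈p∪q⁻ p ⁅ y ⁆ x∈p∪⁅y⁆)

transpose-replaces : ∀ {m} {S : Subset m} {u v z} → u ∈ S → v ∉ S →
  z ∈ (S - u) ∪ ⁅ v ⁆ → PC.transpose u v z ∈ S
transpose-replaces {S = S} {u} {v} u∈S v∉S z∈T with x∈p∪q⁻ (S - u) ⁅ v ⁆ z∈T
... | inj₂ z∈⁅v⁆ rewrite x∈⁅y⁆⇒x≡y v z∈⁅v⁆ | transpose-matchʳ u v = u∈S
... | inj₁ z∈S-u = subst (_∈ S) (sym (transpose-fixed u v z≢u z≢v)) z∈S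
  where
  z∈S = p─q⊆p S ⁅ u ⁆ z∈S-u
  z≢u = λ { refl → x∈p─q⇒x∉q S ⁅ u ⁆ z∈S-u (x∈⁅x⁆ u) }
  z≢v = λ { refl → v∉S z∈S }

module _ {G : Graph} {u v : V G} (tt : TrueTwins G u v) {S : Subset (n G)}
         (u∈S : u ∈ S) (gp : GeneralPosition G S) where

  ¬shortest-through-v : ∀ {r s x y} → r ∈ S → s ∈ S → r ≢ s → r ≢ v → s ≢ v →
    (w : Walk G x y k) → IsShortest G w → r ∈W w → s ∈W w → ¬ v ∈W w
  ¬shortest-through-v {r = r} {s = s} r∈S s∈S r≢s r≢v s≢v w sh r∈w s∈w v∈w with r ≟ u | s ≟ u
  ... | yes refl | _ =
    ¬shortest-through-swapped-edge (trueTwins⇒swap tt)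
      (transpose-fixed u v (≢-sym r≢s) s≢v) (transpose-matchˡ u v) (transpose-matchʳ u v)
      (trueTwins⇒adj {G} tt r≢v) r≢s (≢-sym s≢v) w sh r∈w v∈w s∈w
  ... | no r≢u | yes refl =
    ¬shortest-through-swapped-edge (trueTwins⇒swap tt)
      (transpose-fixed u v r≢u r≢v) (transpose-matchˡ u v) (transpose-matchʳ u v)
      (trueTwins⇒adj {G} tt s≢v) (≢-sym r≢s) (≢-sym r≢v) w sh s∈w v∈w r∈w
  ... | no r≢u | no s≢u =
    gp r s u r∈S s∈S u∈S r≢s r≢u s≢u
      (on-common-shortest-path-image (trueTwins⇒swap tt)
        (transpose-fixed u v r≢u r≢v) (transpose-fixed u v s≢u s≢v) (transpose-matchʳ u v)
        (_ , _ , _ , w , sh , r∈w , s∈w , v∈w))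

  private
    ∈S : ∀ {z} → z ∈ S ∪ ⁅ v ⁆ → z ≢ v → z ∈ S
    ∈S = x∈p∪⁅y⁆∧x≢y⇒x∈p

  generalPosition-insert-twin : GeneralPosition G (S ∪ ⁅ v ⁆)
  generalPosition-insert-twin a b c a∈T b∈T c∈T a≢b a≢c b≢c
                              abc@(_ , _ , _ , w , sh , a∈w , b∈w , c∈w)
    with a ≟ v | b ≟ v | c ≟ v
  ... | yes refl | _ | _ =
    ¬shortest-through-v (∈S b∈T (≢-sym a≢b)) (∈S c∈T (≢-sym a≢c)) b≢c (≢-sym a≢b) (≢-sym a≢c)
      w sh b∈w c∈w a∈w
  ... | no a≢v | yes refl | _ =
    ¬shortest-through-v (∈S a∈T a≢v) (∈S c∈T (≢-sym b≢c)) a≢c a≢v (≢-sym b≢c) w sh a∈w c∈w b∈w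
  ... | no a≢v | no b≢v | yes refl =
    ¬shortest-through-v (∈S a∈T a≢v) (∈S b∈T b≢v) a≢b a≢v b≢v w sh a∈w b∈w c∈w
  ... | no a≢v | no b≢v | no c≢v =
    gp a b c (∈S a∈T a≢v) (∈S b∈T b≢v) (∈S c∈T c≢v) a≢b a≢c b≢c abc

lemma2p2 : (G : Graph) (u v : V G) →
    (FalseTwins G u v → ∀ S → u ∈ S → v ∉ S →
       GeneralPosition G S → GeneralPosition G ((S - u) ∪ ⁅ v ⁆))
    × (FalseTwins G u v → ∀ S → u ∈ S → v ∉ S →
       MutualVisibility G S → MutualVisibility G ((S - u) ∪ ⁅ v ⁆))
    × (TrueTwins G u v → ∀ S → u ∈ S →
       GeneralPosition G S → GeneralPosition G (S ∪ ⁅ v ⁆))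
lemma2p2 G u v =
    (λ ft S u∈S v∉S → generalPosition-pullback (falseTwins⇒swap ft) (transpose-replaces u∈S v∉S))
  , (λ ft S u∈S v∉S → mutualVisibility-pullback (falseTwins⇒swap ft) (transpose-replaces u∈S v∉S))
  , (λ tt S u∈S → generalPosition-insert-twin tt u∈S)
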